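{- Let $p$ be an odd prime and let $E: Y^2=(X-x_0)(X^2+CX+D)$, with $x_0,C,D\in\mathbb{F}_p$ and $X^2+CX+D$ irreducible over $\mathbb{F}_p$, be an elliptic curve (of type I). Let $\mathcal{D}_2=x_0^2+Cx_0+D$, $\mathcal{P}_2(X)=X^2-2x_0X-Cx_0-D$ and $\mathcal{P}_4(X)=X^4+2CX^3+6DX^2+(-8x_0D+2CD+2x_0C^2)X+(4D-C^2)x_0^2+D^2$. Then the degrees of the irreducible factors over $\mathbb{F}_p$ are as follows: if $\left(\frac{\mathcal{D}_2}{p}\right)=+1$ and $p\equiv 1\pmod 4$: $\mathcal{P}_2$ splits as $(1)(1)$ and $\mathcal{P}_4$ is irreducible $(4)$; if $\left(\frac{\mathcal{D}_2}{p}\right)=+1$ and $p\equiv 3\pmod 4$: $\mathcal{P}_2$ splits as $(1)(1)$ and $\mathcal{P}_4$ as $(2)(2)$; if $\left(\frac{\mathcal{D}_2}{p}\right)=-1$ and $p\equiv 1\pmod 4$: $\mathcal{P}_2$ is irreducible $(2)$ and $\mathcal{P}_4$ splits as $(2)(2)$; if $\left(\frac{\mathcal{D}_2}{p}\right)=-1$ and $p\equiv 3\pmod 4$: $\mathcal{P}_2$ is irreducible $(2)$ and $\mathcal{P}_4$ is irreducible $(4)$.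
   Context: $\left(\frac{\cdot}{p}\right)$ is the Legendre symbol; a splitting $(d_1)\cdots(d_k)$ means the polynomial factors over $\mathbb{F}_p$ into irreducible factors of degrees $d_1,\dots,d_k$. -}

module Defs where

open import Data.Nat as ℕ using (ℕ; zero; suc)
open import Data.Integer using (ℤ; +_; _+_; _-_; _*_; -_; 0ℤ; 1ℤ)
open import Data.Integer.Divisibility using (_∣_)
open import Data.List using (List; []; _∷_; _++_; map)
open import Data.Vec using (Vec; toList)
open import Data.Product using (Σ; ∃; _×_)
open import Relation.Nullary using (¬_)

-- Elements of F_p are represented by integers; equality in F_p is congruence mod p.
infix 4 _≡_[mod_]
_≡_[mod_] : ℤ → ℤ → ℕ → Set
a ≡ b [mod p ] = (+ p) ∣ (a - b)

-- Polynomials over F_p: coefficient lists, lowest degree first.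
Poly : Set
Poly = List ℤ

coeff : Poly → ℕ → ℤ
coeff []       _       = 0ℤ
coeff (a ∷ _)  zero    = a
coeff (_ ∷ f)  (suc i) = coeff f i

_+ₚ_ : Poly → Poly → Poly
[]      +ₚ g       = g
(a ∷ f) +ₚ []      = a ∷ f
(a ∷ f) +ₚ (b ∷ g) = (a + b) ∷ (f +ₚ g)

_*ₚ_ : Poly → Poly → Poly
[]      *ₚ g = []
(a ∷ f) *ₚ g = map (a *_) g +ₚ (0ℤ ∷ (f *ₚ g))

PolyEq : ℕ → Poly → Poly → Set
PolyEq p f g = ∀ i → coeff f i ≡ coeff g i [mod p ]

monic : ∀ {d} → Vec ℤ d → Poly
monic cs = toList cs ++ (1ℤ ∷ [])

Irreducible : ℕ → ∀ {d} → Vec ℤ d → Set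
Irreducible p {d} cs =
  (1 ℕ.≤ d) ×
  (∀ a b (g : Vec ℤ (suc a)) (h : Vec ℤ (suc b)) →
     ¬ PolyEq p (monic g *ₚ monic h) (monic cs))

SplitsAs : ℕ → List ℕ → Poly → Set
SplitsAs p []       f = PolyEq p f (1ℤ ∷ [])
SplitsAs p (d ∷ ds) f =
  Σ (Vec ℤ d) λ g → Irreducible p g ×
  Σ Poly λ h → SplitsAs p ds h × PolyEq p (monic g *ₚ h) f

LegendrePlus : ℕ → ℤ → Set
LegendrePlus p a = ¬ (a ≡ 0ℤ [mod p ]) × ∃ λ x → (x * x) ≡ a [mod p ]

LegendreMinus : ℕ → ℤ → Set
LegendreMinus p a = ¬ (a ≡ 0ℤ [mod p ]) × ¬ (∃ λ x → (x * x) ≡ a [mod p ])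

module Submission where

-- q = X² + CX + D is irreducible, so Δ = C² - 4D is a non-residue and F_p(√Δ) = F_{p²}.
-- 𝒫₂ = (X - x₀)² - 𝒟₂ splits exactly when 𝒟₂ is a square, while 𝒫₄ = q² - Δ(X - x₀)² is the
-- norm of q - √Δ (X - x₀): it has no root in F_p, and comparing coefficients shows that it is a
-- product of two quadratics exactly when N = -Δ 𝒟₂ is a square (the factors are then norms of
-- linear polynomials over F_{p²}, built from a point of the conic Y² + ΔW² = 2Δ, YW = -(C + 2x₀)).
-- By Euler's criterion (-1/p) = 1 iff p ≡ 1 (mod 4), so (N/p) = -(-1/p)(𝒟₂/p) decides all four cases.

open import Defs
open import Data.Nat using (ℕ; _%_)
open import Data.Nat.Primality using (Prime)
open import Data.Integer using (ℤ; +_; _+_; _-_; _*_; -_)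
open import Data.List using (List; []; _∷_)
open import Data.Vec using (Vec; []; _∷_)
open import Data.Product using (_×_)
open import Relation.Binary.PropositionalEquality using (_≡_; _≢_)

open import Data.Nat as ℕ using (zero; suc; z≤n; s≤s)
import Data.Nat.Properties as ℕ
import Data.Nat.Divisibility as ℕ
import Data.Nat.DivMod as ℕ
import Data.Nat.Tactic.RingSolver as ℕ-Solver
open import Data.Nat.Primality using (euclidsLemma; prime⇒nonTrivial; prime⇒irreducible; ¬prime[1])
open import Data.Integer using (0ℤ; 1ℤ; ∣_∣; _^_)
import Data.Integer.Properties as ℤ
import Data.Integer.DivMod as ℤ
open import Data.Integer.Divisibility.Signed as Signed using (_∣_)
open import Data.Integer.Tactic.RingSolver using (solve-∀)
open import Data.Fin using (Fin; toℕ; fromℕ<)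
import Data.Fin.Properties as Fin
open import Data.List using (length; map)
open import Data.List.Relation.Unary.All as All using (All; []; _∷_)
open import Data.List.Relation.Unary.AllPairs using (AllPairs; []; _∷_)
open import Data.Sum as Sum using (_⊎_; inj₁; inj₂; [_,_]′; reduce)
open import Data.Product using (∃; ∃₂; _,_; proj₁; proj₂)
open import Data.Empty using (⊥-elim)
open import Function using (_∘_; case_of_)
open import Relation.Nullary using (¬_; Dec; yes; no; map′)
open import Relation.Binary.Definitions using (Decidable; tri<; tri≈; tri>)
open import Relation.Binary.Bundles using (Setoid)
open import Relation.Binary.Structures using (IsEquivalence)
import Relation.Binary.Reasoning.Setoid as SetoidReasoning
open import Level using (0ℓ)
open import Relation.Binary.PropositionalEquality using (refl; sym; trans; cong; cong₂; subst; subst₂; module ≡-Reasoning)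

module Congruence (p : ℕ) where

  infix 4 _≈_ _≉_ _≈?_

  record _≈_ (a b : ℤ) : Set where
    constructor mk≈
    field divides-difference : + p ∣ a - b

  open _≈_ public

  _≉_ : ℤ → ℤ → Set
  a ≉ b = ¬ a ≈ b

  ≈-reflexive : ∀ {a b} → a ≡ b → a ≈ b
  ≈-reflexive {a} refl = mk≈ (subst (+ p ∣_) (sym (ℤ.+-inverseʳ a)) (Signed.∣n⇒∣m*n 0ℤ Signed.∣-refl))

  ≈-refl : ∀ {a} → a ≈ a
  ≈-refl = ≈-reflexive refl

  private
    ∣+ : ∀ {m n} → + p ∣ m → + p ∣ n → + p ∣ m + n
    ∣+ = Signed.∣m∣n⇒∣m+n
    ∣* : ∀ c {m} → + p ∣ m → + p ∣ c * m
    ∣* = Signed.∣n⇒∣m*n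

  combine₁ : ∀ {a₁ b₁ x y} c₁ → a₁ ≈ b₁ → c₁ * (a₁ - b₁) ≡ x - y → x ≈ y
  combine₁ c₁ (mk≈ d₁) eq = mk≈ (subst (+ p ∣_) eq (∣* c₁ d₁))

  combine₂ : ∀ {a₁ b₁ a₂ b₂ x y} c₁ c₂ → a₁ ≈ b₁ → a₂ ≈ b₂ →
             c₁ * (a₁ - b₁) + c₂ * (a₂ - b₂) ≡ x - y → x ≈ y
  combine₂ c₁ c₂ (mk≈ d₁) (mk≈ d₂) eq = mk≈ (subst (+ p ∣_) eq (∣+ (∣* c₁ d₁) (∣* c₂ d₂)))

  combine₃ : ∀ {a₁ b₁ a₂ b₂ a₃ b₃ x y} c₁ c₂ c₃ → a₁ ≈ b₁ → a₂ ≈ b₂ → a₃ ≈ b₃ →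
             c₁ * (a₁ - b₁) + c₂ * (a₂ - b₂) + c₃ * (a₃ - b₃) ≡ x - y → x ≈ y
  combine₃ c₁ c₂ c₃ (mk≈ d₁) (mk≈ d₂) (mk≈ d₃) eq =
    mk≈ (subst (+ p ∣_) eq (∣+ (∣+ (∣* c₁ d₁) (∣* c₂ d₂)) (∣* c₃ d₃)))

  combine₄ : ∀ {a₁ b₁ a₂ b₂ a₃ b₃ a₄ b₄ x y} c₁ c₂ c₃ c₄ →
             a₁ ≈ b₁ → a₂ ≈ b₂ → a₃ ≈ b₃ → a₄ ≈ b₄ →
             c₁ * (a₁ - b₁) + c₂ * (a₂ - b₂) + c₃ * (a₃ - b₃) + c₄ * (a₄ - b₄) ≡ x - y → x ≈ y
  combine₄ c₁ c₂ c₃ c₄ (mk≈ d₁) (mk≈ d₂) (mk≈ d₃) (mk≈ d₄) eq =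
    mk≈ (subst (+ p ∣_) eq (∣+ (∣+ (∣+ (∣* c₁ d₁) (∣* c₂ d₂)) (∣* c₃ d₃)) (∣* c₄ d₄)))

  ≈-sym : ∀ {a b} → a ≈ b → b ≈ a
  ≈-sym {a} {b} h = combine₁ (- 1ℤ) h (identity a b)
    where identity : ∀ a b → - 1ℤ * (a - b) ≡ b - a
          identity = solve-∀

  ≈-trans : ∀ {a b c} → a ≈ b → b ≈ c → a ≈ c
  ≈-trans {a} {b} {c} h₁ h₂ = combine₂ 1ℤ 1ℤ h₁ h₂ (identity a b c)
    where identity : ∀ a b c → 1ℤ * (a - b) + 1ℤ * (b - c) ≡ a - c
          identity = solve-∀

  ≈-isEquivalence : IsEquivalence _≈_
  ≈-isEquivalence = record { refl = ≈-refl ; sym = ≈-sym ; trans = ≈-trans }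

  ≈-setoid : Setoid 0ℓ 0ℓ
  ≈-setoid = record { isEquivalence = ≈-isEquivalence }

  module ≈-Reasoning = SetoidReasoning ≈-setoid

  -≈0⇒≈ : ∀ {a b} → a - b ≈ 0ℤ → a ≈ b
  -≈0⇒≈ {a} {b} h = combine₁ 1ℤ h (identity a b)
    where identity : ∀ a b → 1ℤ * (a - b - 0ℤ) ≡ a - b
          identity = solve-∀

  +-cong : ∀ {a b c d} → a ≈ b → c ≈ d → a + c ≈ b + d
  +-cong {a} {b} {c} {d} h₁ h₂ = combine₂ 1ℤ 1ℤ h₁ h₂ (identity a b c d)
    where identity : ∀ a b c d → 1ℤ * (a - b) + 1ℤ * (c - d) ≡ (a + c) - (b + d)
          identity = solve-∀

  *-cong : ∀ {a b c d} → a ≈ b → c ≈ d → a * c ≈ b * d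
  *-cong {a} {b} {c} {d} h₁ h₂ = combine₂ c b h₁ h₂ (identity a b c d)
    where identity : ∀ a b c d → c * (a - b) + b * (c - d) ≡ a * c - b * d
          identity = solve-∀

  ^-cong : ∀ {a b} k → a ≈ b → a ^ k ≈ b ^ k
  ^-cong zero    h = ≈-refl
  ^-cong (suc k) h = *-cong h (^-cong k h)

  _≈?_ : Decidable _≈_
  a ≈? b = map′ mk≈ divides-difference (+ p Signed.∣? (a - b))

  fromMod : ∀ {a b} → a ≡ b [mod p ] → a ≈ b
  fromMod = mk≈ ∘ Signed.∣ᵤ⇒∣

  toMod : ∀ {a b} → a ≈ b → a ≡ b [mod p ]
  toMod = Signed.∣⇒∣ᵤ ∘ divides-difference

  IsSquare : ℤ → Set
  IsSquare a = ∃ λ x → x * x ≈ a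

  NonSquare : ℤ → Set
  NonSquare a = ¬ IsSquare a

module PrimeModulus {p : ℕ} (prime : Prime p) where

  open Congruence p

  ≈0⇒∣ : ∀ {a} → a ≈ 0ℤ → p ℕ.∣ ∣ a ∣
  ≈0⇒∣ {a} (mk≈ d) = Signed.∣⇒∣ᵤ (subst (+ p ∣_) (ℤ.+-identityʳ a) d)

  ∣⇒≈0 : ∀ {a} → p ℕ.∣ ∣ a ∣ → a ≈ 0ℤ
  ∣⇒≈0 {a} d = mk≈ (subst (+ p ∣_) (sym (ℤ.+-identityʳ a)) (Signed.∣ᵤ⇒∣ d))

  *≈0⇒≈0⊎≈0 : ∀ a b → a * b ≈ 0ℤ → a ≈ 0ℤ ⊎ b ≈ 0ℤ
  *≈0⇒≈0⊎≈0 a b ab≈0 =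
    Sum.map ∣⇒≈0 ∣⇒≈0 (euclidsLemma ∣ a ∣ ∣ b ∣ prime (subst (p ℕ.∣_) (ℤ.abs-* a b) (≈0⇒∣ ab≈0)))

  *-≉0 : ∀ {a b} → a ≉ 0ℤ → b ≉ 0ℤ → a * b ≉ 0ℤ
  *-≉0 {a} {b} a≉0 b≉0 ab≈0 = [ a≉0 , b≉0 ]′ (*≈0⇒≈0⊎≈0 a b ab≈0)

  square≈0⇒≈0 : ∀ {a} → a * a ≈ 0ℤ → a ≈ 0ℤ
  square≈0⇒≈0 {a} a²≈0 = reduce (*≈0⇒≈0⊎≈0 a a a²≈0)

  <p⇒≉0 : ∀ {n} → 0 ℕ.< n → n ℕ.< p → + n ≉ 0ℤ
  <p⇒≉0 {suc n} _ n<p h = ℕ.<⇒≱ n<p (ℕ.∣⇒≤ (≈0⇒∣ h))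

  1≉0 : 1ℤ ≉ 0ℤ
  1≉0 = <p⇒≉0 (s≤s z≤n) (ℕ.nonTrivial⇒n>1 p {{prime⇒nonTrivial prime}})

  *-cancelˡ-≈ : ∀ {c a b} → c ≉ 0ℤ → c * a ≈ c * b → a ≈ b
  *-cancelˡ-≈ {c} {a} {b} c≉0 ca≈cb =
    case *≈0⇒≈0⊎≈0 c (a - b) (combine₁ 1ℤ ca≈cb (factor c a b)) of λ where
      (inj₁ c≈0)   → ⊥-elim (c≉0 c≈0)
      (inj₂ a-b≈0) → -≈0⇒≈ a-b≈0
    where factor : ∀ c a b → 1ℤ * (c * a - c * b) ≡ c * (a - b) - 0ℤ
          factor = solve-∀

infixl 7 _choose_
_choose_ : ℕ → ℕ → ℕ
_     choose zero  = 1
zero  choose suc k = 0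
suc n choose suc k = n choose k ℕ.+ n choose suc k

choose-1+n : ∀ n j → n choose suc (n ℕ.+ j) ≡ 0
choose-1+n zero    j = refl
choose-1+n (suc n) j rewrite choose-1+n n j | sym (ℕ.+-suc n j) | choose-1+n n (suc j) = refl

choose-suc : ∀ n → n choose suc n ≡ 0
choose-suc n = subst (λ m → n choose suc m ≡ 0) (ℕ.+-identityʳ n) (choose-1+n n 0)

choose-diag : ∀ n → n choose n ≡ 1
choose-diag zero    = refl
choose-diag (suc n) rewrite choose-diag n | choose-suc n = refl

choose-absorb : ∀ n k → suc k ℕ.* (suc n choose suc k) ≡ suc n ℕ.* (n choose k)
choose-absorb n zero = trans (ℕ.+-identityʳ _) (trans (n+1-choose-1 n) (sym (ℕ.*-identityʳ (suc n))))
  where n+1-choose-1 : ∀ n → suc n choose 1 ≡ suc n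
        n+1-choose-1 zero    = refl
        n+1-choose-1 (suc n) = cong suc (n+1-choose-1 n)
choose-absorb zero    (suc k) = ℕ.*-zeroʳ (suc (suc k))
choose-absorb (suc n) (suc k) = begin
  suc (suc k) ℕ.* (a ℕ.+ b)
    ≡⟨ shuffle k a b ⟩
  a ℕ.+ suc k ℕ.* a ℕ.+ suc (suc k) ℕ.* b
    ≡⟨ cong₂ (λ x y → a ℕ.+ x ℕ.+ y) (choose-absorb n k) (choose-absorb n (suc k)) ⟩
  a ℕ.+ suc n ℕ.* (n choose k) ℕ.+ suc n ℕ.* (n choose suc k)
    ≡⟨ collect n (n choose k) (n choose suc k) ⟩
  suc (suc n) ℕ.* a
    ∎
  where
    open ≡-Reasoning
    a b : ℕ
    a = suc n choose suc k
    b = suc n choose suc (suc k)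
    shuffle : ∀ k a b → suc (suc k) ℕ.* (a ℕ.+ b) ≡ a ℕ.+ suc k ℕ.* a ℕ.+ suc (suc k) ℕ.* b
    shuffle = ℕ-Solver.solve-∀
    collect : ∀ n c d → c ℕ.+ d ℕ.+ suc n ℕ.* c ℕ.+ suc n ℕ.* d ≡ suc (suc n) ℕ.* (c ℕ.+ d)
    collect = ℕ-Solver.solve-∀

∑ : ℕ → (ℕ → ℤ) → ℤ
∑ zero    f = 0ℤ
∑ (suc m) f = ∑ m f + f m

module Binomial (x : ℤ) where

  term : ℕ → ℕ → ℤ
  term n k = + (n choose k) * x ^ k

  pascal : ∀ n k → term (suc n) (suc k) ≡ term n (suc k) + x * term n k
  pascal n k rewrite ℤ.pos-+ (n choose k) (n choose suc k) =
    identity (+ (n choose k)) (+ (n choose suc k)) x (x ^ k)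
    where identity : ∀ c d x y → (c + d) * (x * y) ≡ d * (x * y) + x * (c * y)
          identity = solve-∀

  pascal-partial : ∀ n m → ∑ (suc m) (term (suc n)) ≡ ∑ (suc m) (term n) + x * ∑ m (term n)
  pascal-partial n zero    = identity x
    where identity : ∀ x → 0ℤ + 1ℤ ≡ 0ℤ + 1ℤ + x * 0ℤ
          identity = solve-∀
  pascal-partial n (suc m) rewrite pascal-partial n m | pascal n m =
    identity (∑ (suc m) (term n)) (∑ m (term n)) (term n m) (term n (suc m)) x
    where identity : ∀ s t a b x → s + x * t + (b + x * a) ≡ s + b + x * (t + a)
          identity = solve-∀

  binomial-theorem : ∀ n → (1ℤ + x) ^ n ≡ ∑ (suc n) (term n)
  binomial-theorem zero    = refl
  binomial-theorem (suc n) = begin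
    (1ℤ + x) * (1ℤ + x) ^ n                   ≡⟨ cong ((1ℤ + x) *_) (binomial-theorem n) ⟩
    (1ℤ + x) * s                              ≡⟨ identity s x ⟩
    s + 0ℤ + x * s                            ≡⟨ cong (λ t → s + t + x * s) top-vanishes ⟨
    s + term n (suc n) + x * s                ≡⟨ pascal-partial n (suc n) ⟨
    ∑ (suc (suc n)) (term (suc n))            ∎
    where
      open ≡-Reasoning
      s : ℤ
      s = ∑ (suc n) (term n)
      top-vanishes : term n (suc n) ≡ 0ℤ
      top-vanishes rewrite choose-suc n = ℤ.*-zeroˡ (x ^ suc n)
      identity : ∀ s x → (1ℤ + x) * s ≡ s + 0ℤ + x * s
      identity = solve-∀

module Fermat (n : ℕ) (prime : Prime (suc n)) where

  p : ℕ
  p = suc n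

  open Congruence p
  open PrimeModulus prime

  p∣p-choose : ∀ k → suc k ℕ.< p → p ℕ.∣ p choose suc k
  p∣p-choose k k+1<p = case euclidsLemma (suc k) (p choose suc k) prime p∣[k+1]C of λ where
      (inj₁ p∣k+1) → ⊥-elim (ℕ.<⇒≱ k+1<p (ℕ.∣⇒≤ p∣k+1))
      (inj₂ p∣C)   → p∣C
    where p∣[k+1]C : p ℕ.∣ suc k ℕ.* (p choose suc k)
          p∣[k+1]C = ℕ.divides (n choose k) (trans (choose-absorb n k) (ℕ.*-comm p (n choose k)))

  module _ (x : ℤ) where

    open Binomial x

    partial-expansion : ∀ m → m ℕ.< p → ∑ (suc m) (term p) ≈ 1ℤ
    partial-expansion zero    _   = ≈-refl
    partial-expansion (suc m) m+1<p =
      combine₂ 1ℤ (x ^ suc m) (partial-expansion m (ℕ.<-trans (ℕ.n<1+n m) m+1<p))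
               (∣⇒≈0 {+ (p choose suc m)} (p∣p-choose m m+1<p))
        (identity (∑ (suc m) (term p)) (+ (p choose suc m)) (x ^ suc m))
      where identity : ∀ s c y → 1ℤ * (s - 1ℤ) + y * (c - 0ℤ) ≡ s + c * y - 1ℤ
            identity = solve-∀

    freshman's-dream : (1ℤ + x) ^ p ≈ 1ℤ + x ^ p
    freshman's-dream = combine₁ 1ℤ (partial-expansion n ℕ.≤-refl) (begin
      1ℤ * (∑ p (term p) - 1ℤ)
        ≡⟨ identity (∑ p (term p)) (x ^ p) ⟩
      ∑ p (term p) + + 1 * x ^ p - (1ℤ + x ^ p)
        ≡⟨ cong (λ c → ∑ p (term p) + + c * x ^ p - (1ℤ + x ^ p)) (choose-diag p) ⟨
      ∑ (suc p) (term p) - (1ℤ + x ^ p)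
        ≡⟨ cong (_- (1ℤ + x ^ p)) (binomial-theorem p) ⟨
      (1ℤ + x) ^ p - (1ℤ + x ^ p)
        ∎)
      where
        open ≡-Reasoning
        identity : ∀ s y → 1ℤ * (s - 1ℤ) ≡ s + 1ℤ * y - (1ℤ + y)
        identity = solve-∀

  fermat-ℕ : ∀ j → (+ j) ^ p ≈ + j
  fermat-ℕ zero    = ≈-reflexive (ℤ.*-zeroˡ ((+ 0) ^ n))
  fermat-ℕ (suc j) = ≈-trans (freshman's-dream (+ j)) (+-cong (≈-refl {1ℤ}) (fermat-ℕ j))

  ≈-mod : ∀ x → x ≈ + (x ℤ.%ℕ p)
  ≈-mod x = combine₁ (x ℤ./ℕ p) (∣⇒≈0 {+ p} ℕ.∣-refl) (begin
      x ℤ./ℕ p * (+ p - 0ℤ)                 ≡⟨ identity (x ℤ./ℕ p) (+ (x ℤ.%ℕ p)) (+ p) ⟩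
      + (x ℤ.%ℕ p) + x ℤ./ℕ p * + p - + (x ℤ.%ℕ p) ≡⟨ cong (_- + (x ℤ.%ℕ p)) (ℤ.a≡a%ℕn+[a/ℕn]*n x p) ⟨
      x - + (x ℤ.%ℕ p)                      ∎)
    where
      open ≡-Reasoning
      identity : ∀ q r P → q * (P - 0ℤ) ≡ r + q * P - r
      identity = solve-∀

  fermat : ∀ x → x ^ p ≈ x
  fermat x = ≈-trans (^-cong p (≈-mod x)) (≈-trans (fermat-ℕ _) (≈-sym (≈-mod x)))

  fermat-≉0 : ∀ {x} → x ≉ 0ℤ → x ^ n ≈ 1ℤ
  fermat-≉0 {x} x≉0 = *-cancelˡ-≈ x≉0 (≈-trans (fermat x) (≈-reflexive (sym (ℤ.*-identityʳ x))))

  inverse : ∀ {x} → x ≉ 0ℤ → ∃ λ y → x * y ≈ 1ℤ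
  inverse {x} x≉0 = x ^ ℕ.pred n , ≈-trans (≈-reflexive (cong (x ^_) (ℕ.suc-pred n))) (fermat-≉0 x≉0)
    where instance
            n-nonZero : ℕ.NonZero n
            n-nonZero = ℕ.>-nonZero (ℕ.≤-pred (ℕ.nonTrivial⇒n>1 p {{prime⇒nonTrivial prime}}))

eval : Poly → ℤ → ℤ
eval []      x = 0ℤ
eval (c ∷ f) x = c + x * eval f x

eval-+ₚ : ∀ f g x → eval (f +ₚ g) x ≡ eval f x + eval g x
eval-+ₚ []      g       x = sym (ℤ.+-identityˡ (eval g x))
eval-+ₚ (a ∷ f) []      x = sym (ℤ.+-identityʳ (eval (a ∷ f) x))
eval-+ₚ (a ∷ f) (b ∷ g) x rewrite eval-+ₚ f g x = identity a b x (eval f x) (eval g x)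
  where identity : ∀ a b x s t → a + b + x * (s + t) ≡ a + x * s + (b + x * t)
        identity = solve-∀

eval-map : ∀ c g x → eval (map (c *_) g) x ≡ c * eval g x
eval-map c []      x = sym (ℤ.*-zeroʳ c)
eval-map c (a ∷ g) x rewrite eval-map c g x = identity c a x (eval g x)
  where identity : ∀ c a x t → c * a + x * (c * t) ≡ c * (a + x * t)
        identity = solve-∀

eval-*ₚ : ∀ f g x → eval (f *ₚ g) x ≡ eval f x * eval g x
eval-*ₚ []      g x = refl
eval-*ₚ (a ∷ f) g x
  rewrite eval-+ₚ (map (a *_) g) (0ℤ ∷ f *ₚ g) x | eval-map a g x | eval-*ₚ f g x =
  identity a x (eval f x) (eval g x)
  where identity : ∀ a x s t → a * t + (0ℤ + x * (s * t)) ≡ (a + x * s) * t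
        identity = solve-∀

coeff-+ₚ : ∀ f g i → coeff (f +ₚ g) i ≡ coeff f i + coeff g i
coeff-+ₚ []      g       i       = sym (ℤ.+-identityˡ _)
coeff-+ₚ (a ∷ f) []      i       = sym (ℤ.+-identityʳ _)
coeff-+ₚ (a ∷ f) (b ∷ g) zero    = refl
coeff-+ₚ (a ∷ f) (b ∷ g) (suc i) = coeff-+ₚ f g i

coeff-map : ∀ c g i → coeff (map (c *_) g) i ≡ c * coeff g i
coeff-map c []      i       = sym (ℤ.*-zeroʳ c)
coeff-map c (a ∷ g) zero    = refl
coeff-map c (a ∷ g) (suc i) = coeff-map c g i

coeff-*ₚ-∷ : ∀ c f g i → coeff ((c ∷ f) *ₚ g) i ≡ c * coeff g i + coeff (0ℤ ∷ f *ₚ g) i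
coeff-*ₚ-∷ c f g i = trans (coeff-+ₚ (map (c *_) g) (0ℤ ∷ f *ₚ g) i) (cong (_+ _) (coeff-map c g i))

coeff-≥length : ∀ f {i} → length f ℕ.≤ i → coeff f i ≡ 0ℤ
coeff-≥length []      _         = refl
coeff-≥length (a ∷ f) (s≤s f≤i) = coeff-≥length f f≤i

coeff-*ₚ-≥length : ∀ f g {i} → length f ℕ.+ length g ℕ.≤ suc i → coeff (f *ₚ g) i ≡ 0ℤ
coeff-*ₚ-≥length []      g _ = refl
coeff-*ₚ-≥length (c ∷ f) g {i} (s≤s fg≤i) = begin
  coeff ((c ∷ f) *ₚ g) i               ≡⟨ coeff-*ₚ-∷ c f g i ⟩
  c * coeff g i + coeff (0ℤ ∷ f *ₚ g) i ≡⟨ cong₂ (λ a b → c * a + b) g-vanishes (shifted i fg≤i) ⟩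
  c * 0ℤ + 0ℤ                           ≡⟨ cong (_+ 0ℤ) (ℤ.*-zeroʳ c) ⟩
  0ℤ                                    ∎
  where
    open ≡-Reasoning
    g-vanishes : coeff g i ≡ 0ℤ
    g-vanishes = coeff-≥length g (ℕ.≤-trans (ℕ.m≤n+m _ _) fg≤i)
    shifted : ∀ i → length f ℕ.+ length g ℕ.≤ i → coeff (0ℤ ∷ f *ₚ g) i ≡ 0ℤ
    shifted zero    _  = refl
    shifted (suc i) le = coeff-*ₚ-≥length f g le

coeff-*ₚ-top : ∀ f g {a b} → length f ≡ suc a → length g ≡ suc b →
               coeff (f *ₚ g) (a ℕ.+ b) ≡ coeff f a * coeff g b
coeff-*ₚ-top (c ∷ []) g {zero} {b} _ _ = begin
  coeff ((c ∷ []) *ₚ g) b                ≡⟨ coeff-*ₚ-∷ c [] g b ⟩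
  c * coeff g b + coeff (0ℤ ∷ []) b      ≡⟨ cong (_+_ (c * coeff g b)) (constant-zero b) ⟩
  c * coeff g b + 0ℤ                     ≡⟨ ℤ.+-identityʳ _ ⟩
  c * coeff g b                          ∎
  where
    open ≡-Reasoning
    constant-zero : ∀ i → coeff (0ℤ ∷ []) i ≡ 0ℤ
    constant-zero zero    = refl
    constant-zero (suc i) = refl
coeff-*ₚ-top (c ∷ f) g {suc a} {b} f≡ g≡ = begin
  coeff ((c ∷ f) *ₚ g) (suc a ℕ.+ b)                    ≡⟨ coeff-*ₚ-∷ c f g (suc a ℕ.+ b) ⟩
  c * coeff g (suc a ℕ.+ b) + coeff (f *ₚ g) (a ℕ.+ b) ≡⟨ cong₂ (λ x y → c * x + y) g-vanishes
                                                             (coeff-*ₚ-top f g (ℕ.suc-injective f≡) g≡) ⟩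
  c * 0ℤ + coeff f a * coeff g b                        ≡⟨ cong (_+ _) (ℤ.*-zeroʳ c) ⟩
  0ℤ + coeff f a * coeff g b                            ≡⟨ ℤ.+-identityˡ _ ⟩
  coeff f a * coeff g b                                 ∎
  where
    open ≡-Reasoning
    g-vanishes : coeff g (suc a ℕ.+ b) ≡ 0ℤ
    g-vanishes = coeff-≥length g (subst (ℕ._≤ suc a ℕ.+ b) (sym g≡) (s≤s (ℕ.m≤n+m b a)))

length-monic : ∀ {d} (cs : Vec ℤ d) → length (monic cs) ≡ suc d
length-monic []       = refl
length-monic (c ∷ cs) = cong suc (length-monic cs)

coeff-monic-top : ∀ {d} (cs : Vec ℤ d) → coeff (monic cs) d ≡ 1ℤ
coeff-monic-top []       = refl
coeff-monic-top (c ∷ cs) = coeff-monic-top cs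

coeff-*ₚ-one : ∀ f i → coeff (f *ₚ (1ℤ ∷ [])) i ≡ coeff f i
coeff-*ₚ-one []      i       = refl
coeff-*ₚ-one (a ∷ f) zero    = trans (ℤ.+-identityʳ _) (ℤ.*-identityʳ a)
coeff-*ₚ-one (a ∷ f) (suc i) = coeff-*ₚ-one f i

eval-monic-linear : ∀ c → eval (monic (c ∷ [])) (- c) ≡ 0ℤ
eval-monic-linear = identity
  where identity : ∀ c → c + (- c) * (1ℤ + (- c) * 0ℤ) ≡ 0ℤ
        identity = solve-∀

divide : Poly → ℤ → Poly
divide []          r = []
divide (c ∷ [])    r = []
divide (c ∷ d ∷ f) r = eval (d ∷ f) r ∷ divide (d ∷ f) r

length-divide : ∀ c f r → length (divide (c ∷ f) r) ≡ length f
length-divide c []      r = refl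
length-divide c (d ∷ f) r = cong suc (length-divide d f r)

eval-divide : ∀ f x r → eval f x ≡ eval f r + (x - r) * eval (divide f r) x
eval-divide []          x r = identity x r
  where identity : ∀ x r → 0ℤ ≡ 0ℤ + (x - r) * 0ℤ
        identity = solve-∀
eval-divide (c ∷ [])    x r = identity c x r
  where identity : ∀ c x r → c + x * 0ℤ ≡ c + r * 0ℤ + (x - r) * 0ℤ
        identity = solve-∀
eval-divide (c ∷ d ∷ f) x r rewrite eval-divide (d ∷ f) x r =
  identity c x r (eval (d ∷ f) r) (eval (divide (d ∷ f) r) x)
  where identity : ∀ c x r s q → c + x * (s + (x - r) * q) ≡ c + r * s + (x - r) * (s + x * q)
        identity = solve-∀

0≢a+1+b : ∀ a b → 0 ≢ a ℕ.+ suc b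
0≢a+1+b a b eq = ℕ.0≢1+n (trans eq (ℕ.+-suc a b))

module Polynomials {p : ℕ} (prime : Prime p) where

  open Congruence p
  open PrimeModulus prime

  eval-cong : ∀ f g → (∀ i → coeff f i ≈ coeff g i) → ∀ x → eval f x ≈ eval g x
  eval-cong []      []      _  x = ≈-refl
  eval-cong []      (b ∷ g) eq x =
    combine₂ 1ℤ x (eq 0) (eval-cong [] g (λ i → eq (suc i)) x) (identity b x (eval g x))
    where identity : ∀ b x t → 1ℤ * (0ℤ - b) + x * (0ℤ - t) ≡ 0ℤ - (b + x * t)
          identity = solve-∀
  eval-cong (a ∷ f) []      eq x =
    combine₂ 1ℤ x (eq 0) (eval-cong f [] (λ i → eq (suc i)) x) (identity a x (eval f x))
    where identity : ∀ a x s → 1ℤ * (a - 0ℤ) + x * (s - 0ℤ) ≡ a + x * s - 0ℤ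
          identity = solve-∀
  eval-cong (a ∷ f) (b ∷ g) eq x = +-cong (eq 0) (*-cong (≈-refl {x}) (eval-cong f g (λ i → eq (suc i)) x))

  coefficient≈ : ∀ f g → PolyEq p f g → ∀ i → coeff f i ≈ coeff g i
  coefficient≈ f g eq i = fromMod {coeff f i} {coeff g i} (eq i)

  factor-eval : ∀ f g h → PolyEq p (g *ₚ h) f → ∀ x → eval f x ≈ eval g x * eval h x
  factor-eval f g h eq x =
    ≈-trans (eval-cong f (g *ₚ h) (λ i → ≈-sym (coefficient≈ (g *ₚ h) f eq i)) x) (≈-reflexive (eval-*ₚ g h x))

  root-of-factorˡ : ∀ f g h x → PolyEq p (g *ₚ h) f → eval g x ≈ 0ℤ → eval f x ≈ 0ℤ
  root-of-factorˡ f g h x eq gx≈0 = begin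
    eval f x             ≈⟨ factor-eval f g h eq x ⟩
    eval g x * eval h x  ≈⟨ *-cong gx≈0 (≈-refl {eval h x}) ⟩
    0ℤ * eval h x        ≡⟨ ℤ.*-zeroˡ (eval h x) ⟩
    0ℤ                   ∎
    where open ≈-Reasoning

  root-of-factorʳ : ∀ f g h x → PolyEq p (g *ₚ h) f → eval h x ≈ 0ℤ → eval f x ≈ 0ℤ
  root-of-factorʳ f g h x eq hx≈0 = begin
    eval f x             ≈⟨ factor-eval f g h eq x ⟩
    eval g x * eval h x  ≈⟨ *-cong (≈-refl {eval g x}) hx≈0 ⟩
    eval g x * 0ℤ        ≡⟨ ℤ.*-zeroʳ (eval g x) ⟩
    0ℤ                   ∎
    where open ≈-Reasoning

  degree-mismatch : ∀ {a b d} (g : Vec ℤ a) (h : Vec ℤ b) (f : Vec ℤ d) →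
                    d ≢ a ℕ.+ b → ¬ PolyEq p (monic g *ₚ monic h) (monic f)
  degree-mismatch {a} {b} {d} g h f d≢a+b eq with ℕ.<-cmp d (a ℕ.+ b)
  ... | tri< d<a+b _ _ = 1≉0 (begin
      1ℤ                                       ≡⟨ product-top ⟨
      coeff (monic g *ₚ monic h) (a ℕ.+ b)     ≈⟨ coefficient≈ (monic g *ₚ monic h) (monic f) eq (a ℕ.+ b) ⟩
      coeff (monic f) (a ℕ.+ b)                ≡⟨ f-vanishes ⟩
      0ℤ                                       ∎)
    where
      open ≈-Reasoning
      product-top : coeff (monic g *ₚ monic h) (a ℕ.+ b) ≡ 1ℤ
      product-top = trans (coeff-*ₚ-top (monic g) (monic h) (length-monic g) (length-monic h))
                          (cong₂ _*_ (coeff-monic-top g) (coeff-monic-top h))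
      f-vanishes : coeff (monic f) (a ℕ.+ b) ≡ 0ℤ
      f-vanishes = coeff-≥length (monic f) (subst (ℕ._≤ a ℕ.+ b) (sym (length-monic f)) d<a+b)
  ... | tri≈ _ d≡a+b _ = d≢a+b d≡a+b
  ... | tri> _ _ d>a+b = 1≉0 (begin
      1ℤ                                       ≡⟨ coeff-monic-top f ⟨
      coeff (monic f) d                        ≈⟨ coefficient≈ (monic g *ₚ monic h) (monic f) eq d ⟨
      coeff (monic g *ₚ monic h) d             ≡⟨ product-vanishes ⟩
      0ℤ                                       ∎)
    where
      open ≈-Reasoning
      product-vanishes : coeff (monic g *ₚ monic h) d ≡ 0ℤ
      product-vanishes = coeff-*ₚ-≥length (monic g) (monic h)
        (subst₂ ℕ._≤_ (sym (cong₂ ℕ._+_ (length-monic g) (length-monic h))) refl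
                (s≤s (subst (ℕ._≤ d) (sym (ℕ.+-suc a b)) d>a+b)))

  divide-≈0 : ∀ g r → eval g r ≈ 0ℤ → All (_≈ 0ℤ) (divide g r) → All (_≈ 0ℤ) g
  divide-≈0 []          r _    _            = []
  divide-≈0 (c ∷ [])    r c≈0  _            = combine₁ 1ℤ c≈0 (identity c r) ∷ []
    where identity : ∀ c r → 1ℤ * (c + r * 0ℤ - 0ℤ) ≡ c - 0ℤ
          identity = solve-∀
  divide-≈0 (c ∷ d ∷ g) r gr≈0 (q≈0 ∷ qs≈0) =
    combine₂ 1ℤ (- r) gr≈0 q≈0 (identity c r (eval (d ∷ g) r)) ∷ divide-≈0 (d ∷ g) r q≈0 qs≈0
    where identity : ∀ c r q → 1ℤ * (c + r * q - 0ℤ) + - r * (q - 0ℤ) ≡ c - 0ℤ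
          identity = solve-∀

  roots⇒coefficients≈0 : ∀ f rs → length rs ≡ length f → AllPairs _≉_ rs →
                         All (λ r → eval f r ≈ 0ℤ) rs → All (_≈ 0ℤ) f
  roots⇒coefficients≈0 []      []       _   _                _             = []
  roots⇒coefficients≈0 (c ∷ f) (r ∷ rs) len (r≉rs ∷ distinct) (fr≈0 ∷ froots) =
    divide-≈0 (c ∷ f) r fr≈0
      (roots⇒coefficients≈0 (divide (c ∷ f) r) rs len′ distinct (All.zipWith quotient-root (r≉rs , froots)))
    where
      len′ : length rs ≡ length (divide (c ∷ f) r)
      len′ = trans (ℕ.suc-injective len) (sym (length-divide c f r))
      quotient-root : ∀ {x} → r ≉ x × eval (c ∷ f) x ≈ 0ℤ → eval (divide (c ∷ f) r) x ≈ 0ℤ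
      quotient-root {x} (r≉x , fx≈0) =
        case *≈0⇒≈0⊎≈0 (x - r) (eval (divide (c ∷ f) r) x) (combine₂ 1ℤ (- 1ℤ) fx≈0 fr≈0 remainder) of λ where
          (inj₁ x-r≈0) → ⊥-elim (r≉x (≈-sym (-≈0⇒≈ x-r≈0)))
          (inj₂ q≈0)   → q≈0
        where
          identity : ∀ a b → 1ℤ * (a + b - 0ℤ) + - 1ℤ * (a - 0ℤ) ≡ b - 0ℤ
          identity = solve-∀
          remainder : 1ℤ * (eval (c ∷ f) x - 0ℤ) + - 1ℤ * (eval (c ∷ f) r - 0ℤ) ≡ (x - r) * eval (divide (c ∷ f) r) x - 0ℤ
          remainder = trans (cong (λ t → 1ℤ * (t - 0ℤ) + - 1ℤ * (eval (c ∷ f) r - 0ℤ)) (eval-divide (c ∷ f) x r))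
                            (identity (eval (c ∷ f) r) ((x - r) * eval (divide (c ∷ f) r) x))

  irreducible-linear : ∀ c → Irreducible p (c ∷ [])
  irreducible-linear c = s≤s z≤n , λ a b g h →
    degree-mismatch g h (c ∷ []) (λ eq → 0≢a+1+b a b (ℕ.suc-injective eq))

  irreducible-quadratic : ∀ c₀ c₁ → (∀ r → eval (monic (c₀ ∷ c₁ ∷ [])) r ≉ 0ℤ) →
                          Irreducible p (c₀ ∷ c₁ ∷ [])
  irreducible-quadratic c₀ c₁ no-root = s≤s z≤n , factors
    where
      factors : ∀ a b (g : Vec ℤ (suc a)) (h : Vec ℤ (suc b)) →
                ¬ PolyEq p (monic g *ₚ monic h) (monic (c₀ ∷ c₁ ∷ []))
      factors zero    zero    (c ∷ []) h eq =
        no-root (- c) (root-of-factorˡ _ (monic (c ∷ [])) (monic h) (- c) eq (≈-reflexive (eval-monic-linear c)))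
      factors zero    (suc b) g h = degree-mismatch g h (c₀ ∷ c₁ ∷ []) (λ ())
      factors (suc a) b       g h = degree-mismatch g h (c₀ ∷ c₁ ∷ [])
                                      (λ eq → 0≢a+1+b a b (ℕ.suc-injective (ℕ.suc-injective eq)))

  irreducible-quartic : ∀ (f : Vec ℤ 4) → (∀ r → eval (monic f) r ≉ 0ℤ) →
                        (∀ (g h : Vec ℤ 2) → ¬ PolyEq p (monic g *ₚ monic h) (monic f)) →
                        Irreducible p f
  irreducible-quartic f no-root no-quadratic-factors = s≤s z≤n , factors
    where
      factors : ∀ a b (g : Vec ℤ (suc a)) (h : Vec ℤ (suc b)) → ¬ PolyEq p (monic g *ₚ monic h) (monic f)
      factors 0 0 g h = degree-mismatch g h f (λ ())
      factors 0 1 g h = degree-mismatch g h f (λ ())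
      factors 0 2 (c ∷ []) h eq =
        no-root (- c) (root-of-factorˡ (monic f) (monic (c ∷ [])) (monic h) (- c) eq (≈-reflexive (eval-monic-linear c)))
      factors 0 (suc (suc (suc b))) g h = degree-mismatch g h f (λ ())
      factors 1 0 g h = degree-mismatch g h f (λ ())
      factors 1 1 g h = no-quadratic-factors g h
      factors 1 (suc (suc b)) g h = degree-mismatch g h f (λ ())
      factors 2 0 g (c ∷ []) eq =
        no-root (- c) (root-of-factorʳ (monic f) (monic g) (monic (c ∷ [])) (- c) eq (≈-reflexive (eval-monic-linear c)))
      factors 2 (suc b) g h = degree-mismatch g h f (λ ())
      factors (suc (suc (suc a))) b g h = degree-mismatch g h f
        (λ eq → 0≢a+1+b a b (ℕ.suc-injective (ℕ.suc-injective (ℕ.suc-injective (ℕ.suc-injective eq)))))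

  product-of-linears : ∀ a b {c₀ c₁} → a * b ≈ c₀ → a + b ≈ c₁ →
                       PolyEq p (monic (a ∷ []) *ₚ monic (b ∷ [])) (monic (c₀ ∷ c₁ ∷ []))
  product-of-linears a b {c₀} {c₁} ab≈c₀ a+b≈c₁ i = toMod (coefficient i)
    where
      coefficient : ∀ i → coeff (monic (a ∷ []) *ₚ monic (b ∷ [])) i ≈ coeff (monic (c₀ ∷ c₁ ∷ [])) i
      coefficient 0 = combine₁ 1ℤ ab≈c₀ (identity a b c₀)
        where identity : ∀ a b c → 1ℤ * (a * b - c) ≡ a * b + 0ℤ - c
              identity = solve-∀
      coefficient 1 = combine₁ 1ℤ a+b≈c₁ (identity a b c₁)
        where identity : ∀ a b c → 1ℤ * (a + b - c) ≡ a * 1ℤ + (1ℤ * b + 0ℤ) - c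
              identity = solve-∀
      coefficient (suc (suc i)) = ≈-refl

  irreducible⇒no-root : ∀ {c₀ c₁} → Irreducible p (c₀ ∷ c₁ ∷ []) →
                        ∀ r → eval (monic (c₀ ∷ c₁ ∷ [])) r ≉ 0ℤ
  irreducible⇒no-root {c₀} {c₁} (_ , irreducible) r root =
    irreducible 0 0 (- r ∷ []) (r + c₁ ∷ [])
      (product-of-linears (- r) (r + c₁) (combine₁ (- 1ℤ) root (identity r c₀ c₁)) (≈-reflexive (identity′ r c₁)))
    where
      identity : ∀ r c₀ c₁ → - 1ℤ * (c₀ + r * (c₁ + r * (1ℤ + r * 0ℤ)) - 0ℤ) ≡ - r * (r + c₁) - c₀
      identity = solve-∀
      identity′ : ∀ r c₁ → - r + (r + c₁) ≡ c₁
      identity′ = solve-∀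

  data QuadraticFactorisation (g₀ g₁ h₀ h₁ : ℤ) : Vec ℤ 4 → Set where
    factorisation : ∀ {c₀ c₁ c₂ c₃} →
                    g₀ * h₀ ≈ c₀ → g₀ * h₁ + g₁ * h₀ ≈ c₁ → g₀ + g₁ * h₁ + h₀ ≈ c₂ → g₁ + h₁ ≈ c₃ →
                    QuadraticFactorisation g₀ g₁ h₀ h₁ (c₀ ∷ c₁ ∷ c₂ ∷ c₃ ∷ [])

  product-of-quadratics : ∀ {g₀ g₁ h₀ h₁} f → QuadraticFactorisation g₀ g₁ h₀ h₁ f →
                          PolyEq p (monic (g₀ ∷ g₁ ∷ []) *ₚ monic (h₀ ∷ h₁ ∷ [])) (monic f)
  product-of-quadratics {g₀} {g₁} {h₀} {h₁} f@(c₀ ∷ c₁ ∷ c₂ ∷ c₃ ∷ []) (factorisation e₀ e₁ e₂ e₃) i =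
    toMod (coefficient i)
    where
      coefficient : ∀ i → coeff (monic (g₀ ∷ g₁ ∷ []) *ₚ monic (h₀ ∷ h₁ ∷ [])) i ≈ coeff (monic f) i
      coefficient 0 = combine₁ 1ℤ e₀ (identity g₀ h₀ c₀)
        where identity : ∀ g₀ h₀ c → 1ℤ * (g₀ * h₀ - c) ≡ g₀ * h₀ + 0ℤ - c
              identity = solve-∀
      coefficient 1 = combine₁ 1ℤ e₁ (identity g₀ g₁ h₀ h₁ c₁)
        where identity : ∀ g₀ g₁ h₀ h₁ c → 1ℤ * (g₀ * h₁ + g₁ * h₀ - c) ≡ g₀ * h₁ + (g₁ * h₀ + 0ℤ) - c
              identity = solve-∀
      coefficient 2 = combine₁ 1ℤ e₂ (identity g₀ g₁ h₀ h₁ c₂)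
        where identity : ∀ g₀ g₁ h₀ h₁ c → 1ℤ * (g₀ + g₁ * h₁ + h₀ - c) ≡ g₀ * 1ℤ + (g₁ * h₁ + (1ℤ * h₀ + 0ℤ)) - c
              identity = solve-∀
      coefficient 3 = combine₁ 1ℤ e₃ (identity g₁ h₁ c₃)
        where identity : ∀ g₁ h₁ c → 1ℤ * (g₁ + h₁ - c) ≡ g₁ * 1ℤ + 1ℤ * h₁ - c
              identity = solve-∀
      coefficient (suc (suc (suc (suc i)))) = ≈-refl

  quadratic-factorisation : ∀ g₀ g₁ h₀ h₁ f →
                            PolyEq p (monic (g₀ ∷ g₁ ∷ []) *ₚ monic (h₀ ∷ h₁ ∷ [])) (monic f) →
                            QuadraticFactorisation g₀ g₁ h₀ h₁ f
  quadratic-factorisation g₀ g₁ h₀ h₁ f@(c₀ ∷ c₁ ∷ c₂ ∷ c₃ ∷ []) eq =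
    factorisation (combine₁ 1ℤ (coefficient 0) (identity₀ g₀ h₀ c₀))
                  (combine₁ 1ℤ (coefficient 1) (identity₁ g₀ g₁ h₀ h₁ c₁))
                  (combine₁ 1ℤ (coefficient 2) (identity₂ g₀ g₁ h₀ h₁ c₂))
                  (combine₁ 1ℤ (coefficient 3) (identity₃ g₁ h₁ c₃))
    where
      coefficient : ∀ i → coeff (monic (g₀ ∷ g₁ ∷ []) *ₚ monic (h₀ ∷ h₁ ∷ [])) i ≈ coeff (monic f) i
      coefficient = coefficient≈ (monic (g₀ ∷ g₁ ∷ []) *ₚ monic (h₀ ∷ h₁ ∷ [])) (monic f) eq
      identity₀ : ∀ g₀ h₀ c → 1ℤ * (g₀ * h₀ + 0ℤ - c) ≡ g₀ * h₀ - c
      identity₀ = solve-∀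
      identity₁ : ∀ g₀ g₁ h₀ h₁ c → 1ℤ * (g₀ * h₁ + (g₁ * h₀ + 0ℤ) - c) ≡ g₀ * h₁ + g₁ * h₀ - c
      identity₁ = solve-∀
      identity₂ : ∀ g₀ g₁ h₀ h₁ c → 1ℤ * (g₀ * 1ℤ + (g₁ * h₁ + (1ℤ * h₀ + 0ℤ)) - c) ≡ g₀ + g₁ * h₁ + h₀ - c
      identity₂ = solve-∀
      identity₃ : ∀ g₁ h₁ c → 1ℤ * (g₁ * 1ℤ + 1ℤ * h₁ - c) ≡ g₁ + h₁ - c
      identity₃ = solve-∀

  irreducible⇒splits : ∀ {d} (f : Vec ℤ d) → Irreducible p f → SplitsAs p (d ∷ []) (monic f)
  irreducible⇒splits f irreducible =
    f , irreducible , 1ℤ ∷ [] , (λ i → toMod (≈-refl {coeff (1ℤ ∷ []) i})) ,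
    (λ i → toMod (≈-reflexive (coeff-*ₚ-one (monic f) i)))

  irreducible-factors⇒splits : ∀ {d e} {g : Vec ℤ d} {h : Vec ℤ e} F → Irreducible p g → Irreducible p h →
                               PolyEq p (monic g *ₚ monic h) F → SplitsAs p (d ∷ e ∷ []) F
  irreducible-factors⇒splits {g = g} {h} F g-irreducible h-irreducible eq =
    g , g-irreducible , monic h , irreducible⇒splits h h-irreducible , eq

^-distribʳ-* : ∀ a b k → (a * b) ^ k ≡ a ^ k * b ^ k
^-distribʳ-* a b zero    = refl
^-distribʳ-* a b (suc k) rewrite ^-distribʳ-* a b k = identity a b (a ^ k) (b ^ k)
  where identity : ∀ a b x y → a * b * (x * y) ≡ a * x * (b * y)
        identity = solve-∀

-1^[t+t] : ∀ t → (- 1ℤ) ^ (t ℕ.+ t) ≡ 1ℤ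
-1^[t+t] zero    = refl
-1^[t+t] (suc t) rewrite ℕ.+-suc t t | -1^[t+t] t = refl

monomial : ℕ → Poly
monomial zero    = 1ℤ ∷ []
monomial (suc j) = 0ℤ ∷ monomial j

eval-monomial : ∀ j x → eval (monomial j) x ≡ x ^ j
eval-monomial zero    x = trans (cong (_+_ 1ℤ) (ℤ.*-zeroʳ x)) (ℤ.+-identityʳ 1ℤ)
eval-monomial (suc j) x = trans (ℤ.+-identityˡ _) (cong (x *_) (eval-monomial j x))

length-monomial : ∀ j → length (monomial j) ≡ suc j
length-monomial zero    = refl
length-monomial (suc j) = cong suc (length-monomial j)

even-or-odd : ∀ m → (∃ λ t → m ≡ t ℕ.+ t) ⊎ (∃ λ t → m ≡ suc (t ℕ.+ t))
even-or-odd zero = inj₁ (0 , refl)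
even-or-odd (suc m) with even-or-odd m
... | inj₁ (t , refl) = inj₂ (t , refl)
... | inj₂ (t , refl) = inj₁ (suc t , cong suc (sym (ℕ.+-suc t t)))

[1+4t]%4≡1 : ∀ t → suc ((t ℕ.+ t) ℕ.+ (t ℕ.+ t)) % 4 ≡ 1
[1+4t]%4≡1 t = trans (cong (_% 4) (identity t)) (ℕ.[m+kn]%n≡m%n 1 t 4)
  where identity : ∀ t → suc ((t ℕ.+ t) ℕ.+ (t ℕ.+ t)) ≡ 1 ℕ.+ t ℕ.* 4
        identity = ℕ-Solver.solve-∀

[3+4t]%4≡3 : ∀ t → suc (suc (t ℕ.+ t) ℕ.+ suc (t ℕ.+ t)) % 4 ≡ 3
[3+4t]%4≡3 t = trans (cong (_% 4) (identity t)) (ℕ.[m+kn]%n≡m%n 3 t 4)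
  where identity : ∀ t → suc (suc (t ℕ.+ t) ℕ.+ suc (t ℕ.+ t)) ≡ 3 ℕ.+ t ℕ.* 4
        identity = ℕ-Solver.solve-∀

%4≡1⇒even : ∀ m → suc (m ℕ.+ m) % 4 ≡ 1 → ∃ λ t → m ≡ t ℕ.+ t
%4≡1⇒even m r with even-or-odd m
... | inj₁ even       = even
... | inj₂ (t , refl) with () ← trans (sym ([3+4t]%4≡3 t)) r

%4≡3⇒odd : ∀ m → suc (m ℕ.+ m) % 4 ≡ 3 → ∃ λ t → m ≡ suc (t ℕ.+ t)
%4≡3⇒odd m r with even-or-odd m
... | inj₂ odd        = odd
... | inj₁ (t , refl) with () ← trans (sym ([1+4t]%4≡1 t)) r

odd-prime : ∀ {p} → Prime p → p ≢ 2 → ∃ λ k → p ≡ suc (suc k ℕ.+ suc k)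
odd-prime {p} p-prime p≢2 with even-or-odd p
... | inj₂ (suc k , p≡) = k , p≡
... | inj₂ (zero , refl) = ⊥-elim (¬prime[1] p-prime)
... | inj₁ (t , p≡t+t) with prime⇒irreducible p-prime (ℕ.divides t (trans p≡t+t (identity t)))
  where identity : ∀ t → t ℕ.+ t ≡ t ℕ.* 2
        identity = ℕ-Solver.solve-∀
...   | inj₁ ()
...   | inj₂ 2≡p = ⊥-elim (p≢2 (sym 2≡p))

module QuadraticResidues (k : ℕ) (prime : Prime (suc (suc k ℕ.+ suc k))) where

  m : ℕ
  m = suc k

  p : ℕ
  p = suc (m ℕ.+ m)

  open Congruence p
  open PrimeModulus prime
  open Fermat (m ℕ.+ m) prime using (fermat-≉0; inverse; ≈-mod)
  open Polynomials prime

  2≉0 : + 2 ≉ 0ℤ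
  2≉0 = <p⇒≉0 (s≤s z≤n) (s≤s (s≤s (ℕ.≤-trans (s≤s z≤n) (ℕ.m≤n+m (suc k) k))))

  -- a search among the residues 0, …, p - 1, kept opaque so that it is never evaluated
  opaque
    IsSquare? : ∀ a → Dec (IsSquare a)
    IsSquare? a = map′ (λ (i , i²≈a) → + toℕ i , i²≈a) residue (Fin.any? (λ i → + toℕ i * + toℕ i ≈? a))
      where
        residue : IsSquare a → ∃ λ (i : Fin p) → + toℕ i * + toℕ i ≈ a
        residue (x , x²≈a) = fromℕ< (ℤ.n%ℕd<d x p) ,
          subst (λ r → + r * + r ≈ a) (sym (Fin.toℕ-fromℕ< (ℤ.n%ℕd<d x p)))
                (≈-trans (*-cong (≈-sym (≈-mod x)) (≈-sym (≈-mod x))) x²≈a)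

  IsSquare-resp-≈ : ∀ {a b} → a ≈ b → IsSquare a → IsSquare b
  IsSquare-resp-≈ a≈b (x , x²≈a) = x , ≈-trans x²≈a a≈b

  NonSquare⇒≉0 : ∀ {a} → NonSquare a → a ≉ 0ℤ
  NonSquare⇒≉0 ¬square a≈0 = ¬square (0ℤ , ≈-sym a≈0)

  square-quotient : ∀ a {b c} → b ≉ 0ℤ → a * a ≈ c * (b * b) → IsSquare c
  square-quotient a {b} {c} b≉0 a²≈cb² =
    a * y , combine₂ (y * y) (c * (b * y + 1ℤ)) a²≈cb² (proj₂ (inverse b≉0)) (identity a b c y)
    where
      y : ℤ
      y = proj₁ (inverse b≉0)
      identity : ∀ a b c y → y * y * (a * a - c * (b * b)) + c * (b * y + 1ℤ) * (b * y - 1ℤ) ≡ a * y * (a * y) - c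
      identity = solve-∀

  square*square : ∀ {a b} → IsSquare a → IsSquare b → IsSquare (a * b)
  square*square {a} {b} (x , x²≈a) (y , y²≈b) = x * y , ≈-trans (≈-reflexive (identity x y)) (*-cong x²≈a y²≈b)
    where identity : ∀ x y → x * y * (x * y) ≡ x * x * (y * y)
          identity = solve-∀

  square*nonsquare : ∀ {a b} → IsSquare a → a ≉ 0ℤ → NonSquare b → NonSquare (a * b)
  square*nonsquare {a} {b} (t , t²≈a) a≉0 ¬square-b (z , z²≈ab) = ¬square-b (square-quotient z t≉0 z²≈bt²)
    where
      t≉0 : t ≉ 0ℤ
      t≉0 t≈0 = a≉0 (≈-trans (≈-sym t²≈a) (*-cong t≈0 t≈0))
      z²≈bt² : z * z ≈ b * (t * t)
      z²≈bt² = begin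
        z * z        ≈⟨ z²≈ab ⟩
        a * b        ≈⟨ *-cong (≈-sym t²≈a) (≈-refl {b}) ⟩
        t * t * b    ≡⟨ ℤ.*-comm (t * t) b ⟩
        b * (t * t)  ∎
        where open ≈-Reasoning

  X^m-1 : Poly
  X^m-1 = - 1ℤ ∷ monomial k

  eval-X^m-1 : ∀ x → eval X^m-1 x ≡ - 1ℤ + x ^ m
  eval-X^m-1 x = cong (λ t → - 1ℤ + x * t) (eval-monomial k x)

  squares : ℕ → List ℤ
  squares zero    = []
  squares (suc j) = + suc j * + suc j ∷ squares j

  length-squares : ∀ j → length (squares j) ≡ j
  length-squares zero    = refl
  length-squares (suc j) = cong suc (length-squares j)

  distinct-residues : ∀ {i j} → i ℕ.< j → j ℕ.< p → + j - + i ≉ 0ℤ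
  distinct-residues {i} {j} i<j j<p j-i≈0 =
    <p⇒≉0 (ℕ.m<n⇒0<n∸m i<j) (ℕ.≤-<-trans (ℕ.m∸n≤m j i) j<p)
      (subst (_≈ 0ℤ) (trans (ℤ.m-n≡m⊖n j i) (ℤ.⊖-≥ (ℕ.<⇒≤ i<j))) j-i≈0)

  distinct-squares : ∀ {i j} → i ℕ.< j → j ℕ.≤ m → + j * + j ≉ + i * + i
  distinct-squares {i} {j} i<j j≤m j²≈i² =
    case *≈0⇒≈0⊎≈0 (+ j - + i) (+ j + + i) (combine₁ 1ℤ j²≈i² (identity (+ j) (+ i))) of λ where
      (inj₁ j-i≈0) → distinct-residues i<j (s≤s (ℕ.≤-trans j≤m (ℕ.m≤m+n m m))) j-i≈0
      (inj₂ j+i≈0) → <p⇒≉0 (ℕ.<-≤-trans (ℕ.≤-<-trans z≤n i<j) (ℕ.m≤m+n j i))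
                            (s≤s (ℕ.+-mono-≤ j≤m (ℕ.≤-trans (ℕ.<⇒≤ i<j) j≤m)))
                            (subst (_≈ 0ℤ) (sym (ℤ.pos-+ j i)) j+i≈0)
    where identity : ∀ j i → 1ℤ * (j * j - i * i) ≡ (j - i) * (j + i) - 0ℤ
          identity = solve-∀

  squares-distinct : ∀ j → j ℕ.≤ m → AllPairs _≉_ (squares j)
  squares-distinct zero    _   = []
  squares-distinct (suc j) j<m = smaller j (ℕ.n<1+n j) ∷ squares-distinct j (ℕ.<⇒≤ j<m)
    where
      smaller : ∀ i → i ℕ.< suc j → All (+ suc j * + suc j ≉_) (squares i)
      smaller zero    _   = []
      smaller (suc i) i<j = distinct-squares i<j j<m ∷ smaller i (ℕ.<-trans (ℕ.n<1+n i) i<j)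

  square^m≈1 : ∀ {x} → x ≉ 0ℤ → (x * x) ^ m ≈ 1ℤ
  square^m≈1 {x} x≉0 =
    ≈-trans (≈-reflexive (trans (^-distribʳ-* x x m) (sym (ℤ.^-distribˡ-+-* x m m)))) (fermat-≉0 x≉0)

  X^m-1-root : ∀ a → a ^ m ≈ 1ℤ → eval X^m-1 a ≈ 0ℤ
  X^m-1-root a a^m≈1 =
    combine₁ 1ℤ a^m≈1 (trans (identity (a ^ m)) (cong (_- 0ℤ) (sym (eval-X^m-1 a))))
    where identity : ∀ y → 1ℤ * (y - 1ℤ) ≡ - 1ℤ + y - 0ℤ
          identity = solve-∀

  squares-roots : ∀ j → j ℕ.≤ m → All (λ r → eval X^m-1 r ≈ 0ℤ) (squares j)
  squares-roots zero    _   = []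
  squares-roots (suc j) j<m =
    X^m-1-root (+ suc j * + suc j) (square^m≈1 (<p⇒≉0 (s≤s z≤n) (s≤s (ℕ.≤-trans j<m (ℕ.m≤m+n m m)))))
    ∷ squares-roots j (ℕ.<⇒≤ j<m)

  -- a non-residue with a^m ≈ 1 would be an (m+1)-st root of X^m - 1
  nonsquare^m≉1 : ∀ {a} → NonSquare a → a ^ m ≉ 1ℤ
  nonsquare^m≉1 {a} ¬square a^m≈1 =
    1≉0 (combine₁ (- 1ℤ) (All.head (roots⇒coefficients≈0 X^m-1 (a ∷ squares m) length≡ distinct roots)) refl)
    where
      length≡ : length (a ∷ squares m) ≡ length X^m-1
      length≡ = cong suc (trans (length-squares m) (sym (length-monomial k)))
      apart : ∀ j → All (a ≉_) (squares j)
      apart zero    = []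
      apart (suc j) = (λ a≈j² → ¬square (+ suc j , ≈-sym a≈j²)) ∷ apart j
      distinct : AllPairs _≉_ (a ∷ squares m)
      distinct = apart m ∷ squares-distinct m ℕ.≤-refl
      roots : All (λ r → eval X^m-1 r ≈ 0ℤ) (a ∷ squares m)
      roots = X^m-1-root a a^m≈1 ∷ squares-roots m ℕ.≤-refl

  1≉-1 : 1ℤ ≉ - 1ℤ
  1≉-1 1≈-1 = 2≉0 (combine₁ 1ℤ 1≈-1 refl)

  euler-nonsquare : ∀ {a} → NonSquare a → a ^ m ≈ - 1ℤ
  euler-nonsquare {a} ¬square =
    case *≈0⇒≈0⊎≈0 (a ^ m - 1ℤ) (a ^ m + 1ℤ) (combine₁ 1ℤ y²≈1 (factor (a ^ m))) of λ where
      (inj₁ y-1≈0) → ⊥-elim (nonsquare^m≉1 ¬square (-≈0⇒≈ y-1≈0))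
      (inj₂ y+1≈0) → combine₁ 1ℤ y+1≈0 (shift (a ^ m))
    where
      y²≈1 : a ^ m * a ^ m ≈ 1ℤ
      y²≈1 = ≈-trans (≈-reflexive (sym (ℤ.^-distribˡ-+-* a m m))) (fermat-≉0 (NonSquare⇒≉0 ¬square))
      factor : ∀ y → 1ℤ * (y * y - 1ℤ) ≡ (y - 1ℤ) * (y + 1ℤ) - 0ℤ
      factor = solve-∀
      shift : ∀ y → 1ℤ * (y + 1ℤ - 0ℤ) ≡ y - - 1ℤ
      shift = solve-∀

  euler-square : ∀ {a} → IsSquare a → a ≉ 0ℤ → a ^ m ≈ 1ℤ
  euler-square {a} (x , x²≈a) a≉0 = ≈-trans (^-cong m (≈-sym x²≈a)) (square^m≈1 x≉0)
    where x≉0 : x ≉ 0ℤ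
          x≉0 x≈0 = a≉0 (≈-trans (≈-sym x²≈a) (*-cong x≈0 x≈0))

  nonsquare*nonsquare : ∀ {a b} → NonSquare a → NonSquare b → IsSquare (a * b)
  nonsquare*nonsquare {a} {b} ¬square-a ¬square-b = case IsSquare? (a * b) of λ where
      (yes square)    → square
      (no ¬square-ab) → ⊥-elim (1≉-1 (begin
        1ℤ                  ≈⟨ *-cong (euler-nonsquare ¬square-a) (euler-nonsquare ¬square-b) ⟨
        a ^ m * b ^ m       ≡⟨ ^-distribʳ-* a b m ⟨
        (a * b) ^ m         ≈⟨ euler-nonsquare ¬square-ab ⟩
        - 1ℤ                ∎))
    where open ≈-Reasoning

  -1≉0 : - 1ℤ ≉ 0ℤ
  -1≉0 -1≈0 = 1≉0 (combine₁ (- 1ℤ) -1≈0 refl)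

  -1-square : p % 4 ≡ 1 → IsSquare (- 1ℤ)
  -1-square p≡1 = case IsSquare? (- 1ℤ) of λ where
      (yes square) → square
      (no ¬square) → ⊥-elim (1≉-1 (begin
        1ℤ              ≡⟨ -1^m≡1 ⟨
        (- 1ℤ) ^ m      ≈⟨ euler-nonsquare ¬square ⟩
        - 1ℤ            ∎))
    where
      open ≈-Reasoning
      -1^m≡1 : (- 1ℤ) ^ m ≡ 1ℤ
      -1^m≡1 = let (t , m≡t+t) = %4≡1⇒even m p≡1 in trans (cong ((- 1ℤ) ^_) m≡t+t) (-1^[t+t] t)

  -1-nonsquare : p % 4 ≡ 3 → NonSquare (- 1ℤ)
  -1-nonsquare p≡3 square = 1≉-1 (begin
      1ℤ            ≈⟨ euler-square square -1≉0 ⟨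
      (- 1ℤ) ^ m    ≡⟨ -1^m≡-1 ⟩
      - 1ℤ          ∎)
    where
      open ≈-Reasoning
      -1^m≡-1 : (- 1ℤ) ^ m ≡ - 1ℤ
      -1^m≡-1 = let (t , m≡1+t+t) = %4≡3⇒odd m p≡3 in trans (cong ((- 1ℤ) ^_) m≡1+t+t) (cong (- 1ℤ *_) (-1^[t+t] t))

module TypeI (k : ℕ) (prime : Prime (suc (suc k ℕ.+ suc k)))
             (x₀ C D : ℤ) (q-irreducible : Irreducible (suc (suc k ℕ.+ suc k)) (D ∷ C ∷ [])) where

  open QuadraticResidues k prime
  open Congruence p
  open PrimeModulus prime
  open Polynomials prime
  open Fermat (m ℕ.+ m) prime using (inverse)

  Δ : ℤ
  Δ = C * C - + 4 * D

  -Δ : ℤ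
  -Δ = - 1ℤ * Δ

  𝒟₂ : ℤ
  𝒟₂ = x₀ * x₀ + C * x₀ + D

  N : ℤ
  N = 𝒟₂ * -Δ

  κ : ℤ
  κ = C + + 2 * x₀

  P₂ : Vec ℤ 2
  P₂ = (- (C * x₀) - D) ∷ (- (+ 2 * x₀)) ∷ []

  P₄ : Vec ℤ 4
  P₄ = ((+ 4 * D - C * C) * (x₀ * x₀) + D * D)
     ∷ (- (+ 8 * x₀ * D) + + 2 * C * D + + 2 * x₀ * (C * C))
     ∷ (+ 6 * D) ∷ (+ 2 * C) ∷ []

  q : ℤ → ℤ
  q = eval (monic (D ∷ C ∷ []))

  q-no-root : ∀ r → q r ≉ 0ℤ
  q-no-root = irreducible⇒no-root q-irreducible

  half : ℤ
  half = proj₁ (inverse 2≉0)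

  2*half≈1 : + 2 * half ≈ 1ℤ
  2*half≈1 = proj₂ (inverse 2≉0)

  -- a square root s of Δ would give the root (s - C)/2 of q
  Δ-nonsquare : NonSquare Δ
  Δ-nonsquare (s , s²≈Δ) =
    q-no-root (half * (s - C))
      (combine₂ (half * half) (- D - + 2 * D * half - C * s * half + C * C * half) s²≈Δ 2*half≈1 (identity C D s half))
    where
      identity : ∀ C D s h → h * h * (s * s - (C * C - + 4 * D)) + (- D - + 2 * D * h - C * s * h + C * C * h) * (+ 2 * h - 1ℤ)
                           ≡ D + h * (s - C) * (C + h * (s - C) * (1ℤ + h * (s - C) * 0ℤ)) - 0ℤ
      identity = solve-∀

  Δ≉0 : Δ ≉ 0ℤ
  Δ≉0 = NonSquare⇒≉0 Δ-nonsquare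

  -Δ≉0 : -Δ ≉ 0ℤ
  -Δ≉0 = *-≉0 -1≉0 Δ≉0

  eval-P₄ : ∀ r → eval (monic P₄) r ≡ q r * q r - Δ * ((r - x₀) * (r - x₀))
  eval-P₄ r = identity x₀ C D r
    where
      identity : ∀ x₀ C D r →
        (+ 4 * D - C * C) * (x₀ * x₀) + D * D
          + r * ((- (+ 8 * x₀ * D) + + 2 * C * D + + 2 * x₀ * (C * C))
          + r * (+ 6 * D + r * (+ 2 * C + r * (1ℤ + r * 0ℤ))))
        ≡ (D + r * (C + r * (1ℤ + r * 0ℤ))) * (D + r * (C + r * (1ℤ + r * 0ℤ)))
          - (C * C - + 4 * D) * ((r - x₀) * (r - x₀))
      identity = solve-∀

  P₄-no-root : ∀ r → eval (monic P₄) r ≉ 0ℤ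
  P₄-no-root r root = case (r - x₀) ≈? 0ℤ of λ where
      (yes ℓ≈0) → q-no-root r (square≈0⇒≈0 (begin
        q r * q r                      ≈⟨ q²≈Δℓ² ⟩
        Δ * ((r - x₀) * (r - x₀))      ≈⟨ *-cong (≈-refl {Δ}) (*-cong ℓ≈0 ℓ≈0) ⟩
        Δ * 0ℤ                         ≡⟨ ℤ.*-zeroʳ Δ ⟩
        0ℤ                             ∎))
      (no ℓ≉0)  → Δ-nonsquare (square-quotient (q r) ℓ≉0 q²≈Δℓ²)
    where
      open ≈-Reasoning
      q²≈Δℓ² : q r * q r ≈ Δ * ((r - x₀) * (r - x₀))
      q²≈Δℓ² = -≈0⇒≈ (subst (_≈ 0ℤ) (eval-P₄ r) root)

  -- with s = g₀ + h₀ - 2D and u = g₁ - C, the coefficient equations give s ≈ u² - Δ,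
  -- u (h₀ - g₀) ≈ 2x₀Δ - Cs and (h₀ - g₀)² ≈ (s + 2D)² - 4(D² - Δx₀²); eliminating u and h₀ - g₀
  -- leaves s (s² - 4N) ≈ 0
  factorisation-equations : ∀ {g₀ g₁ h₀ h₁} → QuadraticFactorisation g₀ g₁ h₀ h₁ P₄ →
    let s = g₀ + h₀ - + 2 * D; u = g₁ - C in s ≈ u * u - Δ × s * (s * s - + 4 * N) ≈ 0ℤ
  factorisation-equations {g₀} {g₁} {h₀} {h₁} (factorisation e₀ e₁ e₂ e₃) = s≈u²-Δ , s[s²-4N]≈0
    where
      s u : ℤ
      s = g₀ + h₀ - + 2 * D
      u = g₁ - C
      s≈u²-Δ : s ≈ u * u - Δ
      s≈u²-Δ = combine₂ 1ℤ (- g₁) e₂ e₃ (identity x₀ C D g₀ g₁ h₀ h₁)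
        where identity : ∀ x₀ C D g₀ g₁ h₀ h₁ → let Δ = C * C - + 4 * D; s = g₀ + h₀ - + 2 * D; u = g₁ - C in
                1ℤ * (g₀ + g₁ * h₁ + h₀ - + 6 * D) + - g₁ * (g₁ + h₁ - + 2 * C) ≡ s - (u * u - Δ)
              identity = solve-∀
      u[h₀-g₀] : u * (h₀ - g₀) ≈ + 2 * x₀ * Δ - C * s
      u[h₀-g₀] = combine₂ 1ℤ (- g₀) e₁ e₃ (identity x₀ C D g₀ g₁ h₀ h₁)
        where identity : ∀ x₀ C D g₀ g₁ h₀ h₁ → let Δ = C * C - + 4 * D; s = g₀ + h₀ - + 2 * D; u = g₁ - C in
                1ℤ * (g₀ * h₁ + g₁ * h₀ - (- (+ 8 * x₀ * D) + + 2 * C * D + + 2 * x₀ * (C * C))) + - g₀ * (g₁ + h₁ - + 2 * C)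
                  ≡ u * (h₀ - g₀) - (+ 2 * x₀ * Δ - C * s)
              identity = solve-∀
      [h₀-g₀]² : (h₀ - g₀) * (h₀ - g₀) ≈ s * s + + 4 * D * s + + 4 * Δ * (x₀ * x₀)
      [h₀-g₀]² = combine₁ (- + 4) e₀ (identity x₀ C D g₀ h₀)
        where identity : ∀ x₀ C D g₀ h₀ → let Δ = C * C - + 4 * D; s = g₀ + h₀ - + 2 * D in
                - + 4 * (g₀ * h₀ - ((+ 4 * D - C * C) * (x₀ * x₀) + D * D))
                  ≡ (h₀ - g₀) * (h₀ - g₀) - (s * s + + 4 * D * s + + 4 * Δ * (x₀ * x₀))
              identity = solve-∀
      s[s²-4N]≈0 : s * (s * s - + 4 * N) ≈ 0ℤ
      s[s²-4N]≈0 = combine₃ (s * s + + 4 * D * s + + 4 * Δ * (x₀ * x₀)) (- (u * u)) (u * (h₀ - g₀) + (+ 2 * x₀ * Δ - C * s))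
                     s≈u²-Δ [h₀-g₀]² u[h₀-g₀] (identity x₀ C D g₀ g₁ h₀)
        where identity : ∀ x₀ C D g₀ g₁ h₀ →
                let Δ = C * C - + 4 * D; s = g₀ + h₀ - + 2 * D; u = g₁ - C
                    N = (x₀ * x₀ + C * x₀ + D) * (- 1ℤ * Δ); X = s * s + + 4 * D * s + + 4 * Δ * (x₀ * x₀) in
                X * (s - (u * u - Δ)) + - (u * u) * ((h₀ - g₀) * (h₀ - g₀) - X)
                  + (u * (h₀ - g₀) + (+ 2 * x₀ * Δ - C * s)) * (u * (h₀ - g₀) - (+ 2 * x₀ * Δ - C * s))
                  ≡ s * (s * s - + 4 * N) - 0ℤ
              identity = solve-∀

  quadratic-factors⇒N-square : ∀ {g₀ g₁ h₀ h₁} → QuadraticFactorisation g₀ g₁ h₀ h₁ P₄ → IsSquare N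
  quadratic-factors⇒N-square {g₀} {g₁} {h₀} {h₁} factors = case s ≈? 0ℤ of λ where
      (yes s≈0) → ⊥-elim (Δ-nonsquare (u , -≈0⇒≈ (≈-trans (≈-sym s≈u²-Δ) s≈0)))
      (no s≉0)  → case *≈0⇒≈0⊎≈0 s (s * s - + 4 * N) s[s²-4N]≈0 of λ where
        (inj₁ s≈0)     → ⊥-elim (s≉0 s≈0)
        (inj₂ s²-4N≈0) → square-quotient s 2≉0 (combine₁ 1ℤ s²-4N≈0 (identity s N))
    where
      s u : ℤ
      s = g₀ + h₀ - + 2 * D
      u = g₁ - C
      s≈u²-Δ : s ≈ u * u - Δ
      s≈u²-Δ = proj₁ (factorisation-equations factors)
      s[s²-4N]≈0 : s * (s * s - + 4 * N) ≈ 0ℤ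
      s[s²-4N]≈0 = proj₂ (factorisation-equations factors)
      identity : ∀ s N → 1ℤ * (s * s - + 4 * N - 0ℤ) ≡ s * s - N * (+ 2 * + 2)
      identity = solve-∀

  P₄-irreducible : NonSquare N → Irreducible p P₄
  P₄-irreducible ¬square = irreducible-quartic P₄ P₄-no-root λ where
    (g₀ ∷ g₁ ∷ []) (h₀ ∷ h₁ ∷ []) eq → ¬square (quadratic-factors⇒N-square (quadratic-factorisation g₀ g₁ h₀ h₁ P₄ eq))

  -- (X + u - α√Δ)(X + v + β√Δ) = q - √Δ (X - x₀), so the norms of the two factors multiply to P₄
  norm-factorisation : ∀ {u v α β} → u + v ≈ C → u * v - Δ * α * β ≈ D → α - β ≈ 1ℤ → v * α - u * β ≈ - x₀ →
                       QuadraticFactorisation (u * u - Δ * α * α) (+ 2 * u) (v * v - Δ * β * β) (+ 2 * v) P₄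
  norm-factorisation {u} {v} {α} {β} h₁ h₂ h₃ h₄ = factorisation
      (combine₂ (u * v - Δ * α * β + D) (- Δ * (v * α - u * β - x₀)) h₂ h₄ (identity₀ x₀ C D u v α β))
      (combine₄ (+ 2 * u * v - + 2 * Δ * α * β) (+ 2 * C) (+ 2 * Δ * x₀) (- + 2 * Δ * (α - β)) h₁ h₂ h₃ h₄
               (identity₁ x₀ C D u v α β))
      (combine₃ (u + v + C) (+ 2) (- Δ * (α - β + 1ℤ)) h₁ h₂ h₃ (identity₂ x₀ C D u v α β))
      (combine₁ (+ 2) h₁ (identity₃ C u v))
    where
      identity₀ : ∀ x₀ C D u v α β → let Δ = C * C - + 4 * D in
        (u * v - Δ * α * β + D) * (u * v - Δ * α * β - D) + - Δ * (v * α - u * β - x₀) * (v * α - u * β - - x₀)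
          ≡ (u * u - Δ * α * α) * (v * v - Δ * β * β) - ((+ 4 * D - C * C) * (x₀ * x₀) + D * D)
      identity₀ = solve-∀
      identity₁ : ∀ x₀ C D u v α β → let Δ = C * C - + 4 * D in
        (+ 2 * u * v - + 2 * Δ * α * β) * (u + v - C) + + 2 * C * (u * v - Δ * α * β - D)
          + + 2 * Δ * x₀ * (α - β - 1ℤ) + - + 2 * Δ * (α - β) * (v * α - u * β - - x₀)
          ≡ (u * u - Δ * α * α) * (+ 2 * v) + + 2 * u * (v * v - Δ * β * β) - (- (+ 8 * x₀ * D) + + 2 * C * D + + 2 * x₀ * (C * C))
      identity₁ = solve-∀
      identity₂ : ∀ x₀ C D u v α β → let Δ = C * C - + 4 * D in
        (u + v + C) * (u + v - C) + + 2 * (u * v - Δ * α * β - D) + - Δ * (α - β + 1ℤ) * (α - β - 1ℤ)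
          ≡ u * u - Δ * α * α + + 2 * u * (+ 2 * v) + (v * v - Δ * β * β) - + 6 * D
      identity₂ = solve-∀
      identity₃ : ∀ C u v → + 2 * (u + v - C) ≡ + 2 * u + + 2 * v - + 2 * C
      identity₃ = solve-∀

  OnConic : ℤ → ℤ → Set
  OnConic Y W = Y * Y + Δ * W * W ≈ + 2 * Δ × Y * W ≈ - κ

  conic⇒quadratic-factors : ∀ {Y W} → OnConic Y W →
    let u = half * (C - Y); v = half * (C + Y); α = half * (W + 1ℤ); β = half * (W - 1ℤ) in
    QuadraticFactorisation (u * u - Δ * α * α) (+ 2 * u) (v * v - Δ * β * β) (+ 2 * v) P₄
  conic⇒quadratic-factors {Y} {W} (r₁ , r₂) =
    norm-factorisation {half * (C - Y)} {half * (C + Y)} {half * (W + 1ℤ)} {half * (W - 1ℤ)}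
    (combine₁ C 2*half≈1 (identity₁ C Y half))
    (combine₂ (- (half * half)) (D * (+ 2 * half + 1ℤ)) r₁ 2*half≈1 (identity₂ C D Y W half))
    (combine₁ 1ℤ 2*half≈1 (identity₃ W half))
    (combine₂ (+ 2 * (half * half)) (- x₀ * (+ 2 * half + 1ℤ)) r₂ 2*half≈1 (identity₄ x₀ C Y W half))
    where
      identity₁ : ∀ C Y h → C * (+ 2 * h - 1ℤ) ≡ h * (C - Y) + h * (C + Y) - C
      identity₁ = solve-∀
      identity₂ : ∀ C D Y W h → let Δ = C * C - + 4 * D in
        - (h * h) * (Y * Y + Δ * W * W - + 2 * Δ) + D * (+ 2 * h + 1ℤ) * (+ 2 * h - 1ℤ)
          ≡ h * (C - Y) * (h * (C + Y)) - Δ * (h * (W + 1ℤ)) * (h * (W - 1ℤ)) - D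
      identity₂ = solve-∀
      identity₃ : ∀ W h → 1ℤ * (+ 2 * h - 1ℤ) ≡ h * (W + 1ℤ) - h * (W - 1ℤ) - 1ℤ
      identity₃ = solve-∀
      identity₄ : ∀ x₀ C Y W h →
        + 2 * (h * h) * (Y * W - - (C + + 2 * x₀)) + - x₀ * (+ 2 * h + 1ℤ) * (+ 2 * h - 1ℤ)
          ≡ h * (C + Y) * (h * (W + 1ℤ)) - h * (C - Y) * (h * (W - 1ℤ)) - - x₀
      identity₄ = solve-∀

  Δκ²≉0 : κ ≉ 0ℤ → Δ * (κ * κ) ≉ 0ℤ
  Δκ²≉0 κ≉0 = *-≉0 Δ≉0 (*-≉0 κ≉0 κ≉0)

  Δκ²-nonsquare : κ ≉ 0ℤ → NonSquare (Δ * (κ * κ))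
  Δκ²-nonsquare κ≉0 = subst NonSquare (ℤ.*-comm (κ * κ) Δ) (square*nonsquare (κ , ≈-refl) (*-≉0 κ≉0 κ≉0) Δ-nonsquare)

  -- (Δ + 2n)(Δ - 2n) ≈ Δκ² is a non-residue, so one of the two factors is a residue
  Δ+s-square : ∀ n → n * n ≈ N → κ ≉ 0ℤ → ∃ λ s → s * s ≈ + 4 * N × IsSquare (Δ + s)
  Δ+s-square n n²≈N κ≉0 = case IsSquare? (Δ + + 2 * n) of λ where
      (yes square) → + 2 * n , combine₁ (+ 4) n²≈N (identity n N) , square
      (no ¬square₊) → case IsSquare? (Δ - + 2 * n) of λ where
        (yes square) → - (+ 2 * n) , combine₁ (+ 4) n²≈N (identity′ n N) , square
        (no ¬square₋) → ⊥-elim (Δκ²-nonsquare κ≉0 (IsSquare-resp-≈ product (nonsquare*nonsquare ¬square₊ ¬square₋)))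
    where
      identity : ∀ n N → + 4 * (n * n - N) ≡ + 2 * n * (+ 2 * n) - + 4 * N
      identity = solve-∀
      identity′ : ∀ n N → + 4 * (n * n - N) ≡ - (+ 2 * n) * - (+ 2 * n) - + 4 * N
      identity′ = solve-∀
      product : (Δ + + 2 * n) * (Δ - + 2 * n) ≈ Δ * (κ * κ)
      product = combine₁ (- + 4) n²≈N (identity″ x₀ C D n)
        where identity″ : ∀ x₀ C D n → let Δ = C * C - + 4 * D; κ = C + + 2 * x₀ in
                - + 4 * (n * n - (x₀ * x₀ + C * x₀ + D) * (- 1ℤ * Δ)) ≡ (Δ + + 2 * n) * (Δ - + 2 * n) - Δ * (κ * κ)
              identity″ = solve-∀

  square-root⇒conic : ∀ s a → s * s ≈ + 4 * N → a * a ≈ Δ + s → κ ≉ 0ℤ → ∃₂ OnConic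
  square-root⇒conic s a s²≈4N a²≈Δ+s κ≉0 =
    a , - κ * b ,
    *-cancelˡ-≈ (*-≉0 a≉0 a≉0)
      (combine₃ (a * a - Δ + s) (Δ * (κ * κ) * (a * b + 1ℤ)) 1ℤ a²≈Δ+s ab≈1 s²≈4N (identity₁ x₀ C D s a b)) ,
    combine₁ (- κ) ab≈1 (identity₂ κ a b)
    where
      a≉0 : a ≉ 0ℤ
      a≉0 a≈0 = Δκ²≉0 κ≉0 (combine₃ ((Δ - s) * a) (- (Δ - s)) 1ℤ a≈0 a²≈Δ+s s²≈4N (identity₀ x₀ C D s a))
        where identity₀ : ∀ x₀ C D s a → let Δ = C * C - + 4 * D; κ = C + + 2 * x₀; N = (x₀ * x₀ + C * x₀ + D) * (- 1ℤ * Δ) in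
                (Δ - s) * a * (a - 0ℤ) + - (Δ - s) * (a * a - (Δ + s)) + 1ℤ * (s * s - + 4 * N) ≡ Δ * (κ * κ) - 0ℤ
              identity₀ = solve-∀
      b : ℤ
      b = proj₁ (inverse a≉0)
      ab≈1 : a * b ≈ 1ℤ
      ab≈1 = proj₂ (inverse a≉0)
      identity₁ : ∀ x₀ C D s a b → let Δ = C * C - + 4 * D; κ = C + + 2 * x₀; N = (x₀ * x₀ + C * x₀ + D) * (- 1ℤ * Δ) in
        (a * a - Δ + s) * (a * a - (Δ + s)) + Δ * (κ * κ) * (a * b + 1ℤ) * (a * b - 1ℤ) + 1ℤ * (s * s - + 4 * N)
          ≡ a * a * (a * a + Δ * (- κ * b) * (- κ * b)) - a * a * (+ 2 * Δ)
      identity₁ = solve-∀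
      identity₂ : ∀ κ a b → - κ * (a * b - 1ℤ) ≡ a * (- κ * b) - - κ
      identity₂ = solve-∀

  conic-point : IsSquare N → ∃₂ OnConic
  conic-point (n , n²≈N) = case κ ≈? 0ℤ of λ where
      (yes κ≈0) → case IsSquare? (+ 2) of λ where
        (yes (t , t²≈2)) → 0ℤ , t , combine₁ Δ t²≈2 (identity₁ Δ t) , combine₁ 1ℤ κ≈0 (identity₂ κ t)
        (no ¬square) → let (t , t²≈2Δ) = nonsquare*nonsquare ¬square Δ-nonsquare in
                       t , 0ℤ , combine₁ 1ℤ t²≈2Δ (identity₃ Δ t) , combine₁ 1ℤ κ≈0 (identity₄ κ t)
      (no κ≉0)  → let (s , s²≈4N , a , a²≈Δ+s) = Δ+s-square n n²≈N κ≉0 in square-root⇒conic s a s²≈4N a²≈Δ+s κ≉0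
    where
      identity₁ : ∀ Δ t → Δ * (t * t - + 2) ≡ 0ℤ * 0ℤ + Δ * t * t - + 2 * Δ
      identity₁ = solve-∀
      identity₂ : ∀ κ t → 1ℤ * (κ - 0ℤ) ≡ 0ℤ * t - - κ
      identity₂ = solve-∀
      identity₃ : ∀ Δ t → 1ℤ * (t * t - + 2 * Δ) ≡ t * t + Δ * 0ℤ * 0ℤ - + 2 * Δ
      identity₃ = solve-∀
      identity₄ : ∀ κ t → 1ℤ * (κ - 0ℤ) ≡ t * 0ℤ - - κ
      identity₄ = solve-∀

  quadratic-factors⇒splits : ∀ {g₀ g₁ h₀ h₁} → QuadraticFactorisation g₀ g₁ h₀ h₁ P₄ →
                             SplitsAs p (2 ∷ 2 ∷ []) (monic P₄)
  quadratic-factors⇒splits {g₀} {g₁} {h₀} {h₁} factors =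
    irreducible-factors⇒splits {g = g₀ ∷ g₁ ∷ []} {h = h₀ ∷ h₁ ∷ []} (monic P₄)
      (irreducible-quadratic g₀ g₁ λ r root → P₄-no-root r (root-of-factorˡ (monic P₄) G H r eq root))
      (irreducible-quadratic h₀ h₁ λ r root → P₄-no-root r (root-of-factorʳ (monic P₄) G H r eq root))
      eq
    where
      G H : Poly
      G = monic (g₀ ∷ g₁ ∷ [])
      H = monic (h₀ ∷ h₁ ∷ [])
      eq : PolyEq p (G *ₚ H) (monic P₄)
      eq = product-of-quadratics P₄ factors

  P₄-splits-2-2 : IsSquare N → SplitsAs p (2 ∷ 2 ∷ []) (monic P₄)
  P₄-splits-2-2 N-square =
    let (Y , W , on-conic) = conic-point N-square in quadratic-factors⇒splits (conic⇒quadratic-factors {Y} {W} on-conic)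

  P₄-splits-4 : NonSquare N → SplitsAs p (4 ∷ []) (monic P₄)
  P₄-splits-4 ¬square = irreducible⇒splits P₄ (P₄-irreducible ¬square)

  eval-P₂ : ∀ r → eval (monic P₂) r ≡ (r - x₀) * (r - x₀) - 𝒟₂
  eval-P₂ r = identity x₀ C D r
    where identity : ∀ x₀ C D r → - (C * x₀) - D + r * (- (+ 2 * x₀) + r * (1ℤ + r * 0ℤ))
                                  ≡ (r - x₀) * (r - x₀) - (x₀ * x₀ + C * x₀ + D)
          identity = solve-∀

  LegendrePlus⇒ : ∀ {a} → LegendrePlus p a → a ≉ 0ℤ × IsSquare a
  LegendrePlus⇒ (a≢0 , x , x²≡a) = (λ a≈0 → a≢0 (toMod a≈0)) , x , fromMod x²≡a

  LegendreMinus⇒ : ∀ {a} → LegendreMinus p a → NonSquare a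
  LegendreMinus⇒ (_ , ¬square) (x , x²≈a) = ¬square (x , toMod x²≈a)

  P₂-splits-1-1 : LegendrePlus p 𝒟₂ → SplitsAs p (1 ∷ 1 ∷ []) (monic P₂)
  P₂-splits-1-1 χ⁺ = let (_ , t , t²≈𝒟₂) = LegendrePlus⇒ χ⁺ in
    irreducible-factors⇒splits {g = - (x₀ + t) ∷ []} {h = - (x₀ - t) ∷ []} (monic P₂)
      (irreducible-linear (- (x₀ + t))) (irreducible-linear (- (x₀ - t)))
      (product-of-linears (- (x₀ + t)) (- (x₀ - t)) (combine₁ (- 1ℤ) t²≈𝒟₂ (identity₀ x₀ C D t))
                                                    (≈-reflexive (identity₁ x₀ t)))
    where
      identity₀ : ∀ x₀ C D t → - 1ℤ * (t * t - (x₀ * x₀ + C * x₀ + D)) ≡ - (x₀ + t) * - (x₀ - t) - (- (C * x₀) - D)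
      identity₀ = solve-∀
      identity₁ : ∀ x₀ t → - (x₀ + t) + - (x₀ - t) ≡ - (+ 2 * x₀)
      identity₁ = solve-∀

  P₂-splits-2 : LegendreMinus p 𝒟₂ → SplitsAs p (2 ∷ []) (monic P₂)
  P₂-splits-2 χ⁻ = irreducible⇒splits P₂ (irreducible-quadratic _ _ λ r root →
    LegendreMinus⇒ χ⁻ (r - x₀ , -≈0⇒≈ (subst (_≈ 0ℤ) (eval-P₂ r) root)))

  -Δ-nonsquare : IsSquare (- 1ℤ) → NonSquare -Δ
  -Δ-nonsquare -1-square = square*nonsquare -1-square -1≉0 Δ-nonsquare

  -Δ-square : NonSquare (- 1ℤ) → IsSquare -Δ
  -Δ-square -1-nonsquare = nonsquare*nonsquare -1-nonsquare Δ-nonsquare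

  N-nonsquare⁺⁺ : LegendrePlus p 𝒟₂ → IsSquare (- 1ℤ) → NonSquare N
  N-nonsquare⁺⁺ χ⁺ -1-square = let (𝒟₂≉0 , 𝒟₂-square) = LegendrePlus⇒ χ⁺ in
    square*nonsquare 𝒟₂-square 𝒟₂≉0 (-Δ-nonsquare -1-square)

  N-square⁺⁻ : LegendrePlus p 𝒟₂ → NonSquare (- 1ℤ) → IsSquare N
  N-square⁺⁻ χ⁺ -1-nonsquare = square*square (proj₂ (LegendrePlus⇒ χ⁺)) (-Δ-square -1-nonsquare)

  N-square⁻⁺ : LegendreMinus p 𝒟₂ → IsSquare (- 1ℤ) → IsSquare N
  N-square⁻⁺ χ⁻ -1-square = nonsquare*nonsquare (LegendreMinus⇒ χ⁻) (-Δ-nonsquare -1-square)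

  N-nonsquare⁻⁻ : LegendreMinus p 𝒟₂ → NonSquare (- 1ℤ) → NonSquare N
  N-nonsquare⁻⁻ χ⁻ -1-nonsquare =
    subst NonSquare (ℤ.*-comm -Δ 𝒟₂) (square*nonsquare (-Δ-square -1-nonsquare) -Δ≉0 (LegendreMinus⇒ χ⁻))

proposition7 : (p : ℕ) → Prime p → p ≢ 2 → (x₀ C D : ℤ) →
    Irreducible p (D ∷ C ∷ []) →
    let 𝒟₂ = x₀ * x₀ + C * x₀ + D
        𝒫₂ = monic ((- (C * x₀) - D) ∷ (- (+ 2 * x₀)) ∷ [])
        𝒫₄ = monic (((+ 4 * D - C * C) * (x₀ * x₀) + D * D)
                   ∷ (- (+ 8 * x₀ * D) + + 2 * C * D + + 2 * x₀ * (C * C))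
                   ∷ (+ 6 * D) ∷ (+ 2 * C) ∷ [])
    in ((LegendrePlus p 𝒟₂ → p % 4 ≡ 1 →
          SplitsAs p (1 ∷ 1 ∷ []) 𝒫₂ × SplitsAs p (4 ∷ []) 𝒫₄)
      × (LegendrePlus p 𝒟₂ → p % 4 ≡ 3 →
          SplitsAs p (1 ∷ 1 ∷ []) 𝒫₂ × SplitsAs p (2 ∷ 2 ∷ []) 𝒫₄)
      × (LegendreMinus p 𝒟₂ → p % 4 ≡ 1 →
          SplitsAs p (2 ∷ []) 𝒫₂ × SplitsAs p (2 ∷ 2 ∷ []) 𝒫₄)
      × (LegendreMinus p 𝒟₂ → p % 4 ≡ 3 →
          SplitsAs p (2 ∷ []) 𝒫₂ × SplitsAs p (4 ∷ []) 𝒫₄))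
proposition7 p p-prime p≢2 x₀ C D q-irreducible with odd-prime p-prime p≢2
... | k , refl =
    (λ χ⁺ p≡1 → P₂-splits-1-1 χ⁺ , P₄-splits-4   (N-nonsquare⁺⁺ χ⁺ (-1-square p≡1)))
  , (λ χ⁺ p≡3 → P₂-splits-1-1 χ⁺ , P₄-splits-2-2 (N-square⁺⁻ χ⁺ (-1-nonsquare p≡3)))
  , (λ χ⁻ p≡1 → P₂-splits-2 χ⁻   , P₄-splits-2-2 (N-square⁻⁺ χ⁻ (-1-square p≡1)))
  , (λ χ⁻ p≡3 → P₂-splits-2 χ⁻   , P₄-splits-4   (N-nonsquare⁻⁻ χ⁻ (-1-nonsquare p≡3)))
  where
    open QuadraticResidues k p-prime using (-1-square; -1-nonsquare)
    open TypeI k p-prime x₀ C D q-irreducible
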